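{- Let $c$ strands with a specific circular ordering $\pi$ be given, and let $\mathcal{T}$ be any set of $2$-fold rotationally symmetric connected unpseudoknotted secondary structures such that each has a central loop which is an internal loop and these central internal loops are pairwise distinct. Then $|\mathcal{T}|\le\sum_{s\in y}\left(\lVert\mathrm{A}\rVert_s\lVert\mathrm{T}\rVert_s+\lVert\mathrm{G}\rVert_s\lVert\mathrm{C}\rVert_s\right)\le N^2/16$, where $y$ is the fundamental component-type prefix with $\pi=y^2$, the sum is over the strands $s$ of $y$, and $\lVert B\rVert_s$ denotes the number of bases of type $B$ in strand $s$.
   Context: Strands are words over $\{\mathrm{A},\mathrm{C},\mathrm{G},\mathrm{T}\}$ of total length $N$; identical sequences have the same type. A circular ordering $\pi$ is a cyclic string over strand types; $v(\pi)$ is the largest $n$ with $\pi=y^n$ for a prefix $y$; $X^n_m$ is the $m$-th strand of type $X$ in the $n$-th copy of the shortest such prefix. Bases lie on a circle in order $\pi$. A secondary structure $S$ is a set of base pairs between complementary bases (A–T, C–G), each base in at most one pair; $\mathrm{Poly}(S,\pi)$ has covalent bonds (consecutive bases of one strand) as arcs and base pairs as chords; unpseudoknotted means no crossing chords, connected means $\mathrm{Poly}(S,\pi)$ connected. $G^\pi$ is the cyclic group generated by the rotation sending base $i$ of $X^n_m$ to base $i$ of $X^{n+1\bmod v(\pi)}_m$; $S$ is $R$-fold rotationally symmetric if the largest subgroup $H\le G^\pi$ leaving $S$ invariant has order $R$. For a covalent bond $b$, $\mathcal{C}^b_R=\{a(b):a\in H\}$ with $|H|=R$ is admissible for $S$ if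 none of its bonds lies within the shorter circular arc between the endpoints of a base pair of $S$; removing an admissible cut leaves $R$ isomorphic connected components (symmetric slices), and the central loop of $S$ is the unique loop (face of the planar polymer graph) not contained in any slice. An internal loop is a loop bordered by exactly two base pairs and containing no nick. -}

module Defs where

open import Data.Nat using (ℕ; zero; suc; _+_; _*_; _∸_; _≤_; _<_; NonZero)
open import Data.Nat.DivMod using (_%_; _mod_)
open import Data.Bool using (Bool; true; false; if_then_else_)
open import Data.Fin using (Fin; toℕ)
open import Data.List using (List; []; _∷_; _++_; concat; length; lookup)
open import Data.Maybe using (Maybe; just; nothing)
import Data.Maybe as Maybe
open import Data.Product using (Σ; _×_; _,_; ∃)
open import Data.Sum using (_⊎_)
open import Relation.Nullary using (¬_)
open import Relation.Binary.PropositionalEquality using (_≡_; _≢_)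
open import Relation.Binary.Construct.Closure.ReflexiveTransitive using (Star)
open import Relation.Binary.Construct.Closure.Symmetric using (SymClosure)

data Base : Set where
  A C G T : Base

data Compl : Base → Base → Set where
  AT : Compl A T
  TA : Compl T A
  CG : Compl C G
  GC : Compl G C

-- A strand is a word over {A,C,G,T}; its type is the word itself.
Strand : Set
Strand = List Base

-- A circular ordering π is represented by a linear listing of its strands,
-- read from an (arbitrary) starting strand.
Ordering : Set
Ordering = List Strand

power : Ordering → ℕ → Ordering
power y zero    = []
power y (suc n) = y ++ power y n

Nb : Ordering → ℕ
Nb π = length (concat π)

-- Bases are placed on a circle at positions 0 … N-1 in the order π.
baseAt : (π : Ordering) → Fin (Nb π) → Base
baseAt π i = lookup (concat π) i

-- bondedℕ π i = true iff base i and base i+1 (cyclically) are consecutive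
-- bases of one strand, i.e. there is a covalent bond between them
-- (false at the last base of every strand = a nick).
bondedℕ : Ordering → ℕ → Bool
bondedℕ []                     i       = false
bondedℕ ([] ∷ ss)              i       = bondedℕ ss i
bondedℕ ((x ∷ []) ∷ ss)        zero    = false
bondedℕ ((x ∷ []) ∷ ss)        (suc i) = bondedℕ ss i
bondedℕ ((x ∷ y ∷ r) ∷ ss)     zero    = true
bondedℕ ((x ∷ y ∷ r) ∷ ss)     (suc i) = bondedℕ ((y ∷ r) ∷ ss) i

Bonded : (π : Ordering) → Fin (Nb π) → Set
Bonded π x = bondedℕ π (toℕ x) ≡ true

rot : ∀ {N} → ℕ → Fin N → Fin N
rot {suc n} m i = (toℕ i + m) mod (suc n)

-- forward circular distance from p to q
off : ∀ {N} → Fin N → Fin N → ℕ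
off {suc n} p q = ((suc n + toℕ q) ∸ toℕ p) % (suc n)

record Fundamental (π : Ordering) : Set where
  field
    v       : ℕ
    y₀      : Ordering
    decomp  : π ≡ power y₀ v
    maximal : ∀ n y → π ≡ power y n → n ≤ v

  -- number of bases in y₀; the generator of G^π is rotation by L
  L : ℕ
  L = Nb y₀

-- A set of base pairs, each base in at most one pair, encoded by the
-- partner map (partner i = just j iff {i,j} ∈ S).
record SecStruct (π : Ordering) : Set where
  field
    partner : Fin (Nb π) → Maybe (Fin (Nb π))
    sym     : ∀ i j → partner i ≡ just j → partner j ≡ just i
    compl   : ∀ i j → partner i ≡ just j → Compl (baseAt π i) (baseAt π j)

module _ {π : Ordering} (S : SecStruct π) where
  open SecStruct S

  Unpseudoknotted : Set
  Unpseudoknotted = ∀ i j k l → partner i ≡ just j → partner k ≡ just l →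
    ¬ (toℕ i < toℕ k × toℕ k < toℕ j × toℕ j < toℕ l)

  -- edges of Poly(S,π): covalent bonds (arcs) and base pairs (chords)
  PolyEdge : Fin (Nb π) → Fin (Nb π) → Set
  PolyEdge x y = (Bonded π x × y ≡ rot 1 x) ⊎ partner x ≡ just y

  Connected : Set
  Connected = ∀ x y → Star (SymClosure PolyEdge) x y

  InvariantUnder : ℕ → Set
  InvariantUnder m = ∀ i → partner (rot m i) ≡ Maybe.map (rot m) (partner i)

  -- The stabiliser of S in G^π = {rotation by j·L : j < v} is exactly
  -- {id, rotation by k·L}, i.e. S is 2-fold rotationally symmetric and
  -- k·L is the nontrivial element of H.
  TwoFoldBy : Fundamental π → ℕ → Set
  TwoFoldBy F k = 0 < k × k < v × InvariantUnder (k * L)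
                × (∀ j → 0 < j → j < v → InvariantUnder (j * L) → j ≡ k)
    where open Fundamental F

  -- Internal loop bordered by pairs {a,b} and {c,d}: the face bounded by
  -- chord a–b, the circle arc b→c, chord c–d and the circle arc d→a
  -- (arcs in the forward direction), with no other chord and no nick.
  record InternalLoop : Set where
    field
      a b c d  : Fin (Nb π)
      pab      : partner a ≡ just b
      pcd      : partner c ≡ just d
      order    : off b c + off c d + off d a + off a b ≡ Nb π
      pos-bc   : 0 < off b c
      pos-cd   : 0 < off c d
      pos-da   : 0 < off d a
      pos-ab   : 0 < off a b
      free-bc  : ∀ x → 0 < off b x → off b x < off b c → partner x ≡ nothing
      free-da  : ∀ x → 0 < off d x → off d x < off d a → partner x ≡ nothing
      nonick-bc : ∀ x → off b x < off b c → Bonded π x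
      nonick-da : ∀ x → off d x < off d a → Bonded π x

  InLoop : InternalLoop → Fin (Nb π) → Set
  InLoop ℓ x = off b x ≤ off b c ⊎ off d x ≤ off d a
    where open InternalLoop ℓ

  -- The cut C^b_2 = {b, h(b)} for the covalent bond b starting at base i,
  -- where h is rotation by m = k·L (the nontrivial element of H).
  BondInShortArc : Fin (Nb π) → Set
  BondInShortArc j = Σ (Fin (Nb π)) λ p → Σ (Fin (Nb π)) λ q →
    partner p ≡ just q × 2 * off p q ≤ Nb π × off p j < off p q

  Admissible : ℕ → Fin (Nb π) → Set
  Admissible m i = Bonded π i × ¬ BondInShortArc i × ¬ BondInShortArc (rot m i)

  CutEdge : ℕ → Fin (Nb π) → Fin (Nb π) → Fin (Nb π) → Set
  CutEdge m i x y =
    (Bonded π x × x ≢ i × x ≢ rot m i × y ≡ rot 1 x) ⊎ partner x ≡ just y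

  InSlice : ℕ → Fin (Nb π) → InternalLoop → Set
  InSlice m i ℓ = ∀ x y → InLoop ℓ x → InLoop ℓ y →
    Star (SymClosure (CutEdge m i)) x y

  Central : ℕ → InternalLoop → Set
  Central m ℓ = ∃ (Admissible m) × (∀ i → Admissible m i → ¬ InSlice m i ℓ)

SameLoop : ∀ {π} {S S′ : SecStruct π} → InternalLoop S → InternalLoop S′ → Set
SameLoop ℓ ℓ′ =
  (a ≡ a′ × b ≡ b′ × c ≡ c′ × d ≡ d′) ⊎ (a ≡ c′ × b ≡ d′ × c ≡ a′ × d ≡ b′)
  where
    open InternalLoop ℓ
    open InternalLoop ℓ′ renaming (a to a′; b to b′; c to c′; d to d′)

-- An element of 𝒯 together with its central internal loop
record Entry (π : Ordering) (F : Fundamental π) : Set where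
  field
    S       : SecStruct π
    k       : ℕ
    twofold : TwoFoldBy S F k
    conn    : Connected S
    unpk    : Unpseudoknotted S
    loop    : InternalLoop S
    central : Central S (k * Fundamental.L F) loop

eqB : Base → Base → Bool
eqB A A = true
eqB C C = true
eqB G G = true
eqB T T = true
eqB _ _ = false

count : Base → Strand → ℕ
count B []      = 0
count B (x ∷ s) = (if eqB B x then 1 else 0) + count B s

bound : Ordering → ℕ
bound []      = 0
bound (s ∷ y) = (count A s * count T s + count G s * count C s) + bound y

{-# OPTIONS --safe #-}
-- Let L be the number of bases of y, so N = 2L and the nontrivial symmetry of a 2-fold symmetric
-- structure is the half turn by L.  Some bond of an admissible cut lies on an arc of the central
-- loop (otherwise the loop would lie in a slice), and no bond of the cut lies in the short arc of a
-- base pair; hence both pairs a–b and c–d bordering the loop span less than half the circle.  The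
-- half turn maps a–b to a pair that must then sit inside c–d, and vice versa, so it swaps the two
-- pairs.  The loop is therefore determined by the positions of b and c within y.  These lie on one
-- strand (the arc b → c has no nick) and carry complementary bases, and such position pairs number
-- exactly Σ_s (‖A‖‖T‖ + ‖G‖‖C‖).  Finally 4‖A‖‖T‖ ≤ (‖A‖ + ‖T‖)² and summing squares give
-- 4 · bound y ≤ L², that is 16 · bound y ≤ N².
module Submission where

open import Defs
open import Data.Bool using (Bool; true; false; if_then_else_)
open import Data.Empty using (⊥-elim)
open import Data.Fin using (Fin; toℕ)
import Data.Fin as Fin
open import Data.Fin.Properties using (toℕ-fromℕ<; toℕ-injective; toℕ<n)
open import Data.List using (List; []; _∷_; [_]; _++_; concat; length; lookup; map)
open import Data.List.Properties using (length-++; concat-++; length-map; ++-identityʳ)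
open import Data.List.Membership.Propositional using (_∈_)
open import Data.List.Membership.Propositional.Properties using (∈-map⁺; ∈-++⁺ˡ; ∈-++⁺ʳ; ∈-++⁻; ∈-∃++)
open import Data.List.Relation.Unary.All using (All; []; _∷_)
import Data.List.Relation.Unary.All as All
import Data.List.Relation.Unary.All.Properties as All
open import Data.List.Relation.Unary.AllPairs using (AllPairs; []; _∷_)
import Data.List.Relation.Unary.AllPairs as AllPairs
import Data.List.Relation.Unary.AllPairs.Properties as AllPairs
open import Data.List.Relation.Unary.Any using (here; there)
open import Data.List.Relation.Unary.Unique.Propositional using (Unique)
open import Data.Maybe using (Maybe; just; nothing)
import Data.Maybe as Maybe
open import Data.Maybe.Properties using (just-injective)
import Data.Maybe.Properties as Maybe
open import Data.Nat using (ℕ; zero; suc; _+_; _*_; _∸_; _≤_; _<_; z≤n; s≤s; NonZero; _<?_; _≤?_)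
open import Data.Nat.Base using (>-nonZero; >-nonZero⁻¹)
open import Data.Nat.DivMod using (_%_; m<n⇒m%n≡m; m%n<n; [m+n]%n≡m%n; %-distribˡ-+; m%n%n≡m%n; m∣n⇒o%n%m≡o%m)
open import Data.Nat.Divisibility using (_∣_; divides)
open import Data.Nat.Properties
open import Algebra.Properties.CommutativeSemigroup +-commutativeSemigroup using (x∙yz≈y∙xz)
open import Data.Nat.Tactic.RingSolver using (solve-∀)
open import Data.Product using (_×_; _,_; ∃; proj₁; proj₂)
open import Data.Sum using (_⊎_; inj₁; inj₂; swap; [_,_]′)
open import Function using (_∘_)
open import Relation.Binary.Construct.Closure.ReflexiveTransitive using (Star; ε; _◅_; _◅◅_; reverse)
open import Relation.Binary.Construct.Closure.Symmetric using (SymClosure; fwd; bwd; symmetric)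
open import Relation.Binary.Definitions using (tri<; tri≈; tri>)
open import Relation.Binary.PropositionalEquality
  using (_≡_; _≢_; refl; sym; trans; cong; cong₂; subst; subst₂; module ≡-Reasoning)
open import Relation.Nullary using (¬_; yes; no; Dec)
open import Relation.Nullary.Decidable using (_⊎-dec_)

[m+n%o]%o≡[m+n]%o : ∀ m n o .{{_ : NonZero o}} → (m + n % o) % o ≡ (m + n) % o
[m+n%o]%o≡[m+n]%o m n o = begin
  (m + n % o) % o         ≡⟨ %-distribˡ-+ m (n % o) o ⟩
  (m % o + n % o % o) % o ≡⟨ cong (λ k → (m % o + k) % o) (m%n%n≡m%n n o) ⟩
  (m % o + n % o) % o     ≡⟨ %-distribˡ-+ m n o ⟨
  (m + n) % o             ∎
  where open ≡-Reasoning

[m%o+n]%o≡[m+n]%o : ∀ m n o .{{_ : NonZero o}} → (m % o + n) % o ≡ (m + n) % o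
[m%o+n]%o≡[m+n]%o m n o = begin
  (m % o + n) % o ≡⟨ cong (_% o) (+-comm (m % o) n) ⟩
  (n + m % o) % o ≡⟨ [m+n%o]%o≡[m+n]%o n m o ⟩
  (n + m) % o     ≡⟨ cong (_% o) (+-comm n m) ⟩
  (m + n) % o     ∎
  where open ≡-Reasoning

n≤m<n+n⇒m%n+n≡m : ∀ {m n} .{{_ : NonZero n}} → n ≤ m → m < n + n → m % n + n ≡ m
n≤m<n+n⇒m%n+n≡m {m} {n} n≤m m<n+n = begin
  m % n + n             ≡⟨ cong (λ k → k % n + n) (m∸n+n≡m n≤m) ⟨
  (m ∸ n + n) % n + n   ≡⟨ cong (_+ n) ([m+n]%n≡m%n (m ∸ n) n) ⟩
  (m ∸ n) % n + n       ≡⟨ cong (_+ n) (m<n⇒m%n≡m m∸n<n) ⟩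
  m ∸ n + n             ≡⟨ m∸n+n≡m n≤m ⟩
  m                     ∎
  where
  open ≡-Reasoning
  m∸n<n : m ∸ n < n
  m∸n<n = +-cancelʳ-< n (m ∸ n) n (subst (_< n + n) (sym (m∸n+n≡m n≤m)) m<n+n)

double-injective : ∀ {m n} → m + m ≡ n + n → m ≡ n
double-injective {m} {n} eq = *-cancelˡ-≡ m n 2
  (trans (cong (m +_) (+-identityʳ m)) (trans eq (sym (cong (n +_) (+-identityʳ n)))))

toℕ-rot : ∀ {N} .{{_ : NonZero N}} m (i : Fin N) → toℕ (rot m i) ≡ (toℕ i + m) % N
toℕ-rot {suc n} m i = toℕ-fromℕ< _

off<N : ∀ {N} (p q : Fin N) → off p q < N
off<N {suc n} p q = m%n<n (suc n + toℕ q ∸ toℕ p) (suc n)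

rot-off : ∀ {N} (p q : Fin N) → rot (off p q) p ≡ q
rot-off {suc n} p q = toℕ-injective (begin
  toℕ (rot (off p q) p)                  ≡⟨ toℕ-rot (off p q) p ⟩
  (toℕ p + (N + toℕ q ∸ toℕ p) % N) % N  ≡⟨ [m+n%o]%o≡[m+n]%o (toℕ p) _ N ⟩
  (toℕ p + (N + toℕ q ∸ toℕ p)) % N      ≡⟨ cong (_% N) (m+[n∸m]≡n p≤N+q) ⟩
  (N + toℕ q) % N                        ≡⟨ cong (_% N) (+-comm N (toℕ q)) ⟩
  (toℕ q + N) % N                        ≡⟨ [m+n]%n≡m%n (toℕ q) N ⟩
  toℕ q % N                              ≡⟨ m<n⇒m%n≡m (toℕ<n q) ⟩
  toℕ q                                  ∎)
  where
  open ≡-Reasoning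
  N = suc n
  p≤N+q : toℕ p ≤ N + toℕ q
  p≤N+q = ≤-trans (<⇒≤ (toℕ<n p)) (m≤m+n N (toℕ q))

rot-+ : ∀ {N} a b (i : Fin N) → rot a (rot b i) ≡ rot (b + a) i
rot-+ {suc n} a b i = toℕ-injective (begin
  toℕ (rot a (rot b i))   ≡⟨ toℕ-rot a (rot b i) ⟩
  (toℕ (rot b i) + a) % N ≡⟨ cong (λ k → (k + a) % N) (toℕ-rot b i) ⟩
  ((toℕ i + b) % N + a) % N ≡⟨ [m%o+n]%o≡[m+n]%o (toℕ i + b) a N ⟩
  (toℕ i + b + a) % N     ≡⟨ cong (_% N) (+-assoc (toℕ i) b a) ⟩
  (toℕ i + (b + a)) % N   ≡⟨ toℕ-rot (b + a) i ⟨
  toℕ (rot (b + a) i)     ∎)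
  where
  open ≡-Reasoning
  N = suc n

rot-comm : ∀ {N} a b (i : Fin N) → rot a (rot b i) ≡ rot b (rot a i)
rot-comm a b i = begin
  rot a (rot b i) ≡⟨ rot-+ a b i ⟩
  rot (b + a) i   ≡⟨ cong (λ k → rot k i) (+-comm b a) ⟩
  rot (a + b) i   ≡⟨ rot-+ b a i ⟨
  rot b (rot a i) ∎
  where open ≡-Reasoning

rot-cong-% : ∀ {N} .{{_ : NonZero N}} {m m′} → m % N ≡ m′ % N → (i : Fin N) → rot m i ≡ rot m′ i
rot-cong-% {suc n} {m} {m′} eq i = toℕ-injective (begin
  toℕ (rot m i)           ≡⟨ toℕ-rot m i ⟩
  (toℕ i + m) % N         ≡⟨ [m+n%o]%o≡[m+n]%o (toℕ i) m N ⟨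
  (toℕ i + m % N) % N     ≡⟨ cong (λ k → (toℕ i + k) % N) eq ⟩
  (toℕ i + m′ % N) % N    ≡⟨ [m+n%o]%o≡[m+n]%o (toℕ i) m′ N ⟩
  (toℕ i + m′) % N        ≡⟨ toℕ-rot m′ i ⟨
  toℕ (rot m′ i)          ∎)
  where
  open ≡-Reasoning
  N = suc n

rot-zero : ∀ {N} (i : Fin N) → rot 0 i ≡ i
rot-zero {suc n} i = toℕ-injective (trans (toℕ-rot 0 i)
  (trans (cong (_% suc n) (+-identityʳ (toℕ i))) (m<n⇒m%n≡m (toℕ<n i))))

rot-+N : ∀ {N} m (i : Fin N) → rot (m + N) i ≡ rot m i
rot-+N {suc n} m i = rot-cong-% ([m+n]%n≡m%n m (suc n)) i

rot-half : ∀ {N} {m} → m + m ≡ N → (i : Fin N) → rot m (rot m i) ≡ i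
rot-half {m = m} m+m≡N i = begin
  rot m (rot m i) ≡⟨ rot-+ m m i ⟩
  rot (m + m) i   ≡⟨ cong (λ k → rot k i) m+m≡N ⟩
  rot (0 + _) i   ≡⟨ rot-+N 0 i ⟩
  rot 0 i         ≡⟨ rot-zero i ⟩
  i               ∎
  where open ≡-Reasoning

rot-half-sym : ∀ {N} {m} → m + m ≡ N → {p q : Fin N} → rot m p ≡ q → rot m q ≡ p
rot-half-sym m+m≡N {p} refl = rot-half m+m≡N p

rot-injectiveˡ : ∀ {N} .{{_ : NonZero N}} {d e} (p : Fin N) → rot d p ≡ rot e p → d % N ≡ e % N
rot-injectiveˡ {suc n} {d} {e} p eq =
  trans (sym (unwind d)) (trans (cong (λ i → toℕ (rot (N ∸ toℕ p) i)) eq) (unwind e))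
  where
  open ≡-Reasoning
  N = suc n
  unwind : ∀ k → toℕ (rot (N ∸ toℕ p) (rot k p)) ≡ k % N
  unwind k = begin
    toℕ (rot (N ∸ toℕ p) (rot k p))   ≡⟨ cong toℕ (rot-+ (N ∸ toℕ p) k p) ⟩
    toℕ (rot (k + (N ∸ toℕ p)) p)     ≡⟨ toℕ-rot (k + (N ∸ toℕ p)) p ⟩
    (toℕ p + (k + (N ∸ toℕ p))) % N   ≡⟨ cong (_% N) (+-comm (toℕ p) _) ⟩
    (k + (N ∸ toℕ p) + toℕ p) % N     ≡⟨ cong (_% N) (+-assoc k (N ∸ toℕ p) (toℕ p)) ⟩
    (k + (N ∸ toℕ p + toℕ p)) % N     ≡⟨ cong (λ j → (k + j) % N) (m∸n+n≡m (<⇒≤ (toℕ<n p))) ⟩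
    (k + N) % N                       ≡⟨ [m+n]%n≡m%n k N ⟩
    k % N                             ∎

off-unique : ∀ {N} {d} (p q : Fin N) → d < N → rot d p ≡ q → off p q ≡ d
off-unique {suc n} {d} p q d<N refl = begin
  off p q           ≡⟨ m<n⇒m%n≡m (off<N p q) ⟨
  off p q % suc n   ≡⟨ rot-injectiveˡ p (rot-off p q) ⟩
  d % suc n         ≡⟨ m<n⇒m%n≡m d<N ⟩
  d                 ∎
  where open ≡-Reasoning

off-self : ∀ {N} (p : Fin N) → off p p ≡ 0
off-self {suc n} p = off-unique p p (s≤s z≤n) (rot-zero p)

off-injective : ∀ {N} (p : Fin N) {q r} → off p q ≡ off p r → q ≡ r
off-injective p {q} {r} eq =
  trans (sym (rot-off p q)) (trans (cong (λ k → rot k p) eq) (rot-off p r))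

off-rot-rot : ∀ {N} m (p q : Fin N) → off (rot m p) (rot m q) ≡ off p q
off-rot-rot m p q =
  off-unique (rot m p) (rot m q) (off<N p q) (trans (rot-comm (off p q) m p) (cong (rot m) (rot-off p q)))

off-trans-% : ∀ {N} .{{_ : NonZero N}} (p q r : Fin N) → off p r ≡ (off p q + off q r) % N
off-trans-% {suc n} p q r = off-unique p r (m%n<n (off p q + off q r) (suc n)) (begin
  rot ((off p q + off q r) % suc n) p ≡⟨ rot-cong-% (m%n%n≡m%n (off p q + off q r) (suc n)) p ⟩
  rot (off p q + off q r) p           ≡⟨ rot-+ (off q r) (off p q) p ⟨
  rot (off q r) (rot (off p q) p)     ≡⟨ cong (rot (off q r)) (rot-off p q) ⟩
  rot (off q r) q                     ≡⟨ rot-off q r ⟩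
  r                                   ∎)
  where open ≡-Reasoning

off-trans : ∀ {N} (p q r : Fin N) → off p q + off q r < N → off p r ≡ off p q + off q r
off-trans {suc n} p q r lt = trans (off-trans-% p q r) (m<n⇒m%n≡m lt)

off-between : ∀ {N} (p q r : Fin N) → off p q ≤ off p r → off p q + off q r ≡ off p r
off-between {suc n} p q r le with off p q + off q r <? suc n
... | yes lt = sym (off-trans p q r lt)
... | no ≮N = ⊥-elim (<⇒≱ wrapped le)
  where
  wrapped : off p r < off p q
  wrapped = +-cancelʳ-< (suc n) (off p r) (off p q) (begin-strict
    off p r + suc n                           ≡⟨ cong (_+ suc n) (off-trans-% p q r) ⟩
    (off p q + off q r) % suc n + suc n       ≡⟨ n≤m<n+n⇒m%n+n≡m (≮⇒≥ ≮N) (+-mono-< (off<N p q) (off<N q r)) ⟩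
    off p q + off q r                         <⟨ +-monoʳ-< (off p q) (off<N q r) ⟩
    off p q + suc n                           ∎)
    where open ≤-Reasoning

off-+-off : ∀ {N} (p q : Fin N) → p ≢ q → off p q + off q p ≡ N
off-+-off {suc n} p q p≢q with off p q + off q p <? suc n
... | yes lt = ⊥-elim (p≢q (off-injective p (trans (off-self p) (sym off-p-q≡0))))
  where
  off-p-q≡0 : off p q ≡ 0
  off-p-q≡0 = m+n≡0⇒m≡0 (off p q) (trans (sym (off-trans p q p lt)) (off-self p))
... | no ≮N = begin
  off p q + off q p                         ≡⟨ n≤m<n+n⇒m%n+n≡m (≮⇒≥ ≮N) (+-mono-< (off<N p q) (off<N q p)) ⟨
  (off p q + off q p) % suc n + suc n       ≡⟨ cong (_+ suc n) (trans (sym (off-trans-% p q p)) (off-self p)) ⟩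
  suc n                                     ∎
  where open ≡-Reasoning

Nb-++ : ∀ y z → Nb (y ++ z) ≡ Nb y + Nb z
Nb-++ y z = trans (cong length (sym (concat-++ y z))) (length-++ (concat y))

Nb-power : ∀ y n → Nb (power y n) ≡ n * Nb y
Nb-power y zero    = refl
Nb-power y (suc n) = trans (Nb-++ y (power y n)) (cong (Nb y +_) (Nb-power y n))

lookupℕ : {A : Set} → List A → ℕ → Maybe A
lookupℕ []       _       = nothing
lookupℕ (x ∷ xs) zero    = just x
lookupℕ (x ∷ xs) (suc n) = lookupℕ xs n

lookupℕ-toℕ : {A : Set} (xs : List A) (i : Fin (length xs)) → lookupℕ xs (toℕ i) ≡ just (lookup xs i)
lookupℕ-toℕ (x ∷ xs) Fin.zero    = refl
lookupℕ-toℕ (x ∷ xs) (Fin.suc i) = lookupℕ-toℕ xs i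

lookupℕ-++ˡ : {A : Set} (xs ys : List A) {n : ℕ} → n < length xs → lookupℕ (xs ++ ys) n ≡ lookupℕ xs n
lookupℕ-++ˡ (x ∷ xs) ys {zero}  _         = refl
lookupℕ-++ˡ (x ∷ xs) ys {suc n} (s≤s n<l) = lookupℕ-++ˡ xs ys n<l

lookupℕ-++ʳ : {A : Set} (xs ys : List A) (n : ℕ) → lookupℕ (xs ++ ys) (length xs + n) ≡ lookupℕ ys n
lookupℕ-++ʳ []       ys n = refl
lookupℕ-++ʳ (x ∷ xs) ys n = lookupℕ-++ʳ xs ys n

bondedℕ-++ˡ : ∀ y w {z} → z < Nb y → bondedℕ (y ++ w) z ≡ bondedℕ y z
bondedℕ-++ˡ ([] ∷ ss)          w {z}     z<L       = bondedℕ-++ˡ ss w z<L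
bondedℕ-++ˡ ((x ∷ []) ∷ ss)    w {zero}  _         = refl
bondedℕ-++ˡ ((x ∷ []) ∷ ss)    w {suc z} (s≤s z<L) = bondedℕ-++ˡ ss w z<L
bondedℕ-++ˡ ((x ∷ x′ ∷ r) ∷ ss) w {zero}  _         = refl
bondedℕ-++ˡ ((x ∷ x′ ∷ r) ∷ ss) w {suc z} (s≤s z<L) = bondedℕ-++ˡ ((x′ ∷ r) ∷ ss) w z<L

bondedℕ-++ʳ : ∀ y w z → bondedℕ (y ++ w) (Nb y + z) ≡ bondedℕ w z
bondedℕ-++ʳ []                  w z = refl
bondedℕ-++ʳ ([] ∷ ss)           w z = bondedℕ-++ʳ ss w z
bondedℕ-++ʳ ((x ∷ []) ∷ ss)     w z = bondedℕ-++ʳ ss w z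
bondedℕ-++ʳ ((x ∷ x′ ∷ r) ∷ ss) w z = bondedℕ-++ʳ ((x′ ∷ r) ∷ ss) w z

bondedℕ⇒suc<Nb : ∀ y {z} → bondedℕ y z ≡ true → suc z < Nb y
bondedℕ⇒suc<Nb ([] ∷ ss)           {z}     b = bondedℕ⇒suc<Nb ss b
bondedℕ⇒suc<Nb ((x ∷ []) ∷ ss)     {suc z} b = s≤s (bondedℕ⇒suc<Nb ss b)
bondedℕ⇒suc<Nb ((x ∷ x′ ∷ r) ∷ ss) {zero}  b = s≤s (s≤s z≤n)
bondedℕ⇒suc<Nb ((x ∷ x′ ∷ r) ∷ ss) {suc z} b = s≤s (bondedℕ⇒suc<Nb ((x′ ∷ r) ∷ ss) b)

BondedRun : Ordering → ℕ → ℕ → Set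
BondedRun y w n = ∀ t → t < n → bondedℕ y (w + t) ≡ true

-- The last base of y is not bonded, so a run of bonds starting inside y stays inside y.
run-confined : ∀ y (bonded? : ℕ → Bool) → (∀ z → z < Nb y → bonded? z ≡ bondedℕ y z) →
  ∀ {w} n → w < Nb y → (∀ t → t < n → bonded? (w + t) ≡ true) → w + n < Nb y × BondedRun y w n
run-confined y bonded? agrees {w} n w<L run = confined n run , run-in-y
  where
  confined : ∀ k → (∀ t → t < k → bonded? (w + t) ≡ true) → w + k < Nb y
  confined zero    _  = subst (_< Nb y) (sym (+-identityʳ w)) w<L
  confined (suc k) rk = subst (_< Nb y) (sym (+-suc w k))
    (bondedℕ⇒suc<Nb y (trans (sym (agrees (w + k) w+k<L)) (rk k (n<1+n k))))
    where w+k<L = confined k (λ t t<k → rk t (m<n⇒m<1+n t<k))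
  run-in-y : BondedRun y w n
  run-in-y t t<n = trans (sym (agrees (w + t) (<-trans (+-monoʳ-< w t<n) (confined n run)))) (run t t<n)

module _ {π : Ordering} (S : SecStruct π) where
  open SecStruct S using (partner)

  invariantUnder-+ : ∀ {m n} → InvariantUnder S m → InvariantUnder S n → InvariantUnder S (m + n)
  invariantUnder-+ {m} {n} inv-m inv-n i = begin
    partner (rot (m + n) i)                            ≡⟨ cong partner (rot-+ n m i) ⟨
    partner (rot n (rot m i))                          ≡⟨ inv-n (rot m i) ⟩
    Maybe.map (rot n) (partner (rot m i))              ≡⟨ cong (Maybe.map (rot n)) (inv-m i) ⟩
    Maybe.map (rot n) (Maybe.map (rot m) (partner i))  ≡⟨ Maybe.map-∘ (partner i) ⟨
    Maybe.map (rot n ∘ rot m) (partner i)              ≡⟨ Maybe.map-cong (rot-+ n m) (partner i) ⟩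
    Maybe.map (rot (m + n)) (partner i)                ∎
    where open ≡-Reasoning

  invariantUnder-resp : ∀ {m n} → (∀ i → rot m i ≡ rot n i) → InvariantUnder S m → InvariantUnder S n
  invariantUnder-resp {m} {n} m≗n inv-m i = begin
    partner (rot n i)               ≡⟨ cong partner (m≗n i) ⟨
    partner (rot m i)               ≡⟨ inv-m i ⟩
    Maybe.map (rot m) (partner i)   ≡⟨ Maybe.map-cong m≗n (partner i) ⟩
    Maybe.map (rot n) (partner i)   ∎
    where open ≡-Reasoning

Nb≡v*L : ∀ {π} (F : Fundamental π) → Nb π ≡ Fundamental.v F * Fundamental.L F
Nb≡v*L F = trans (cong Nb decomp) (Nb-power y₀ v)
  where open Fundamental F

module _ {π : Ordering} (S : SecStruct π) (F : Fundamental π) where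
  open Fundamental F

  -- Rotation by 2k·L is a symmetry as well, which the uniqueness of k only allows when 2k ≡ v.
  twoFold⇒halfTurn : ∀ {k} → TwoFoldBy S F k → k * L + k * L ≡ Nb π
  twoFold⇒halfTurn {k} (0<k , k<v , inv-k , only-k) with <-cmp (k + k) v
  ... | tri< 2k<v _ _ = ⊥-elim (<-irrefl (sym (only-k (k + k) (<-≤-trans 0<k (m≤m+n k k)) 2k<v inv-2k)) (m<m+n k 0<k))
    where
    inv-2k : InvariantUnder S ((k + k) * L)
    inv-2k = subst (InvariantUnder S) (sym (*-distribʳ-+ L k k)) (invariantUnder-+ S inv-k inv-k)
  ... | tri≈ _ 2k≡v _ = begin
    k * L + k * L   ≡⟨ *-distribʳ-+ L k k ⟨
    (k + k) * L     ≡⟨ cong (_* L) 2k≡v ⟩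
    v * L           ≡⟨ Nb≡v*L F ⟨
    Nb π            ∎
    where open ≡-Reasoning
  ... | tri> _ _ 2k>v = ⊥-elim (<-irrefl (sym (+-cancelˡ-≡ k v k (begin
    k + v         ≡⟨ cong (_+ v) (only-k j 0<j j<v inv-j) ⟨
    j + v         ≡⟨ m∸n+n≡m (<⇒≤ 2k>v) ⟩
    k + k         ∎))) k<v)
    where
    open ≡-Reasoning
    j = k + k ∸ v
    0<j : 0 < j
    0<j = m<n⇒0<n∸m 2k>v
    j<v : j < v
    j<v = +-cancelʳ-< v j v (subst (_< v + v) (sym (m∸n+n≡m (<⇒≤ 2k>v))) (+-mono-< k<v k<v))
    2kL≡jL+N : (k + k) * L ≡ j * L + Nb π
    2kL≡jL+N = begin
      (k + k) * L      ≡⟨ cong (_* L) (m∸n+n≡m (<⇒≤ 2k>v)) ⟨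
      (j + v) * L      ≡⟨ *-distribʳ-+ L j v ⟩
      j * L + v * L    ≡⟨ cong (j * L +_) (Nb≡v*L F) ⟨
      j * L + Nb π     ∎
    inv-j : InvariantUnder S (j * L)
    inv-j = invariantUnder-resp S (rot-+N (j * L))
              (subst (InvariantUnder S) (trans (sym (*-distribʳ-+ L k k)) 2kL≡jL+N) (invariantUnder-+ S inv-k inv-k))

≡just⇒≢nothing : ∀ {A : Set} {x : A} {mx} → mx ≡ just x → mx ≢ nothing
≡just⇒≢nothing refl ()

m+n≡o⇒m<o⇒0<n : ∀ a {t s} → a + t ≡ s → a < s → 0 < t
m+n≡o⇒m<o⇒0<n a {t} refl a<a+t = +-cancelˡ-< a 0 t (subst (_< a + t) (sym (+-identityʳ a)) a<a+t)

module _ {π : Ordering} {S : SecStruct π} where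
  open SecStruct S using (partner)

  PairsSwappedBy : ℕ → InternalLoop S → Set
  PairsSwappedBy h ℓ = rot h a ≡ c × rot h b ≡ d
    where open InternalLoop ℓ

  swapPairs : InternalLoop S → InternalLoop S
  swapPairs ℓ = record
    { a = c ; b = d ; c = a ; d = b ; pab = pcd ; pcd = pab
    ; order = trans (rotate (off b c) (off c d) (off d a) (off a b)) order
    ; pos-bc = pos-da ; pos-cd = pos-ab ; pos-da = pos-bc ; pos-ab = pos-cd
    ; free-bc = free-da ; free-da = free-bc ; nonick-bc = nonick-da ; nonick-da = nonick-bc }
    where
    open InternalLoop ℓ
    rotate : ∀ β γ δ α → δ + α + β + γ ≡ β + γ + δ + α
    rotate = solve-∀

  module _ (ℓ : InternalLoop S) where
    open InternalLoop ℓ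
    private
      α = off a b
      β = off b c
      γ = off c d
      δ = off d a

    OnLoopArc : Fin (Nb π) → Set
    OnLoopArc x = off b x < β ⊎ off d x < δ

    onLoopArc? : ∀ x → Dec (OnLoopArc x)
    onLoopArc? x = off b x <? β ⊎-dec off d x <? δ

    onLoopArc⇒off-b<off-b-a : ∀ {x} → OnLoopArc x → off b x < off b a
    onLoopArc⇒off-b<off-b-a {x} on = subst (off b x <_) (sym off-b-a) (arc on)
      where
      β+γ+δ<N : β + γ + δ < Nb π
      β+γ+δ<N = subst (β + γ + δ <_) order (m<m+n _ pos-ab)
      off-b-d : off b d ≡ β + γ
      off-b-d = off-trans b c d (≤-<-trans (m≤m+n (β + γ) δ) β+γ+δ<N)
      off-b-d+ : ∀ {t} → t < δ → off b d + t < Nb π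
      off-b-d+ {t} t<δ = subst (λ s → s + t < Nb π) (sym off-b-d) (<-trans (+-monoʳ-< (β + γ) t<δ) β+γ+δ<N)
      off-b-a : off b a ≡ β + γ + δ
      off-b-a = trans (off-trans b d a (subst (λ s → s + δ < Nb π) (sym off-b-d) β+γ+δ<N)) (cong (_+ δ) off-b-d)
      arc : OnLoopArc x → off b x < β + γ + δ
      arc (inj₁ lt) = <-≤-trans lt (≤-trans (m≤m+n β γ) (m≤m+n (β + γ) δ))
      arc (inj₂ lt) = subst (_< β + γ + δ) (sym (trans (off-trans b d x (off-b-d+ lt)) (cong (_+ off d x) off-b-d)))
                        (+-monoʳ-< (β + γ) lt)

    partner-beyond-b : ∀ {x y} → partner x ≡ just y → α < off a x → off c x ≤ γ
    partner-beyond-b {x} px α<ax with off b x <? β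
    ... | yes bx<β = ⊥-elim (≡just⇒≢nothing px (free-bc x 0<bx bx<β))
      where
      0<bx : 0 < off b x
      0<bx = m+n≡o⇒m<o⇒0<n α (off-between a b x (<⇒≤ α<ax)) α<ax
    ... | no bx≮β with off c x ≤? γ
    ...   | yes cx≤γ = cx≤γ
    ...   | no cx≰γ = ⊥-elim (≡just⇒≢nothing px (free-da x (m+n≡o⇒m<o⇒0<n γ c-d-x γ<cx) dx<δ))
      where
      γ<cx = ≰⇒> cx≰γ
      c-d-x : γ + off d x ≡ off c x
      c-d-x = off-between c d x (<⇒≤ γ<cx)
      a-x : α + (β + (γ + off d x)) ≡ off a x
      a-x = trans (cong (λ t → α + (β + t)) c-d-x)
              (trans (cong (α +_) (off-between b c x (≮⇒≥ bx≮β))) (off-between a b x (<⇒≤ α<ax)))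
      shuffle : ∀ α β γ t → α + (β + (γ + t)) ≡ (β + γ + α) + t
      shuffle = solve-∀
      shuffle-N : ∀ α β γ δ → β + γ + δ + α ≡ (β + γ + α) + δ
      shuffle-N = solve-∀
      dx<δ : off d x < δ
      dx<δ = +-cancelˡ-< (β + γ + α) (off d x) δ
               (subst₂ _<_ (trans (sym a-x) (shuffle α β γ (off d x))) (trans (sym order) (shuffle-N α β γ δ)) (off<N a x))

module _ {π : Ordering} (S : SecStruct π) (m : ℕ) (i : Fin (Nb π)) where

  CutPath : Fin (Nb π) → Fin (Nb π) → Set
  CutPath = Star (SymClosure (CutEdge S m i))

  stepwise-path : ∀ s t → (∀ u → u < t → CutEdge S m i (rot u s) (rot 1 (rot u s))) → CutPath s (rot t s)
  stepwise-path s zero    _     = subst (CutPath s) (sym (rot-zero s)) ε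
  stepwise-path s (suc t) edges = subst (CutPath s) next
    (stepwise-path s t (λ u u<t → edges u (m<n⇒m<1+n u<t)) ◅◅ fwd (edges t (n<1+n t)) ◅ ε)
    where
    next : rot 1 (rot t s) ≡ rot (suc t) s
    next = trans (rot-+ 1 t s) (cong (λ k → rot k s) (+-comm t 1))

  arc-path : ∀ s len → (∀ x → off s x < len → Bonded π x × x ≢ i × x ≢ rot m i) →
             ∀ x → off s x ≤ len → CutPath s x
  arc-path s len uncut x sx≤len = subst (CutPath s) (rot-off s x) (stepwise-path s (off s x) edge)
    where
    edge : ∀ u → u < off s x → CutEdge S m i (rot u s) (rot 1 (rot u s))
    edge u u<sx with uncut (rot u s) (subst (_< len) (sym (off-unique s (rot u s) (<-trans u<sx (off<N s x)) refl))
                                            (<-≤-trans u<sx sx≤len))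
    ... | bonded , ≢i , ≢mi = inj₁ (bonded , ≢i , ≢mi , refl)

  loop-in-slice : (ℓ : InternalLoop S) → (∀ x → OnLoopArc ℓ x → x ≢ i × x ≢ rot m i) → InSlice S m i ℓ
  loop-in-slice ℓ uncut x y x∈ℓ y∈ℓ = reverse (symmetric _) (from-b x x∈ℓ) ◅◅ from-b y y∈ℓ
    where
    open InternalLoop ℓ
    along-bc : ∀ z → off b z ≤ off b c → CutPath b z
    along-bc = arc-path b (off b c) (λ z lt → nonick-bc z lt , uncut z (inj₁ lt))
    along-da : ∀ z → off d z ≤ off d a → CutPath d z
    along-da = arc-path d (off d a) (λ z lt → nonick-da z lt , uncut z (inj₂ lt))
    from-b : ∀ z → InLoop S ℓ z → CutPath b z
    from-b z (inj₁ le) = along-bc z le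
    from-b z (inj₂ le) = bwd (inj₂ pab) ◅ reverse (symmetric _) (along-da a ≤-refl) ◅◅ along-da z le

cut-meets-loop : ∀ {π} {S : SecStruct π} {m} (ℓ : InternalLoop S) → Central S m ℓ →
                 ∃ λ j → ¬ BondInShortArc S j × OnLoopArc ℓ j
cut-meets-loop {S = S} {m} ℓ ((i , adm@(_ , i-long , mi-long)) , not-in-slice)
  with onLoopArc? ℓ i | onLoopArc? ℓ (rot m i)
... | yes on | _      = i , i-long , on
... | no _   | yes on = rot m i , mi-long , on
... | no i∉  | no mi∉ = ⊥-elim (not-in-slice i adm
  (loop-in-slice S m i ℓ (λ x on → (λ { refl → i∉ on }) , (λ { refl → mi∉ on }))))

pair-shorter-than-half : ∀ {π} (S : SecStruct π) {m} → m + m ≡ Nb π → ∀ {p q j} →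
  SecStruct.partner S q ≡ just p → off q j < off q p → ¬ BondInShortArc S j → off p q < m
pair-shorter-than-half {π} S {m} m+m≡N {p} {q} {j} qp qj<qp j-long =
  +-cancelʳ-< m (off p q) m (begin-strict
    off p q + m         <⟨ +-monoʳ-< (off p q) m<qp ⟩
    off p q + off q p   ≡⟨ off-+-off p q p≢q ⟩
    Nb π                ≡⟨ m+m≡N ⟨
    m + m               ∎)
  where
  open ≤-Reasoning
  p≢q : p ≢ q
  p≢q refl = n≮0 (subst (off p j <_) (off-self p) qj<qp)
  m<qp : m < off q p
  m<qp = ≰⇒> λ qp≤m → j-long (q , p , qp ,
           subst (2 * off q p ≤_) (trans (cong (m +_) (+-identityʳ m)) m+m≡N) (*-monoʳ-≤ 2 qp≤m) , qj<qp)

module _ {π : Ordering} {S : SecStruct π} {m : ℕ} (m+m≡N : m + m ≡ Nb π) (inv-m : InvariantUnder S m)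
         (ℓ : InternalLoop S) (central : Central S m ℓ) where
  open SecStruct S renaming (sym to partner-sym)
  open InternalLoop ℓ

  -- Both pairs are shorter than the half turn, so each one's image lies on the other's side.
  centralLoop-halfTurn : PairsSwappedBy m ℓ
  centralLoop-halfTurn with cut-meets-loop ℓ central
  ... | _ , j-long , j-on = ma≡c , just-injective (trans (sym partner-c) pcd)
    where
    rotated : ∀ {p q} → partner p ≡ just q → partner (rot m p) ≡ just (rot m q)
    rotated {p} pq = trans (inv-m p) (cong (Maybe.map (rot m)) pq)
    α<m : off a b < m
    α<m = pair-shorter-than-half S m+m≡N (partner-sym a b pab) (onLoopArc⇒off-b<off-b-a ℓ j-on) j-long
    γ<m : off c d < m
    γ<m = pair-shorter-than-half S m+m≡N (partner-sym c d pcd) (onLoopArc⇒off-b<off-b-a (swapPairs ℓ) (swap j-on)) j-long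
    m<N : m < Nb π
    m<N = subst (m <_) m+m≡N (m<m+n m (≤-<-trans z≤n α<m))
    off-rot-m : ∀ p → off p (rot m p) ≡ m
    off-rot-m p = off-unique p (rot m p) m<N refl
    ma-near-c : off c (rot m a) ≤ off c d
    ma-near-c = partner-beyond-b ℓ (rotated pab) (subst (off a b <_) (sym (off-rot-m a)) α<m)
    mc-near-a : off (rot m a) c ≤ off a b
    mc-near-a = subst (_≤ off a b) (trans (sym (off-rot-rot m a (rot m c))) (cong (off (rot m a)) (rot-half m+m≡N c)))
                  (partner-beyond-b (swapPairs ℓ) (rotated pcd) (subst (off c d <_) (sym (off-rot-m c)) γ<m))
    γ+α<N : off c d + off a b < Nb π
    γ+α<N = subst (off c d + off a b <_) (trans (regroup (off b c) (off c d) (off d a) (off a b)) order)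
              (m<m+n (off c d + off a b) (<-≤-trans pos-bc (m≤m+n (off b c) (off d a))))
      where
      regroup : ∀ β γ δ α → γ + α + (β + δ) ≡ β + γ + δ + α
      regroup = solve-∀
    ma≡c : rot m a ≡ c
    ma≡c with rot m a Fin.≟ c
    ... | yes eq = eq
    ... | no ma≢c = ⊥-elim (<⇒≱ γ+α<N (begin
      Nb π                            ≡⟨ off-+-off c (rot m a) (λ eq → ma≢c (sym eq)) ⟨
      off c (rot m a) + off (rot m a) c ≤⟨ +-mono-≤ ma-near-c mc-near-a ⟩
      off c d + off a b               ∎))
      where open ≤-Reasoning
    partner-c : partner c ≡ just (rot m b)
    partner-c = subst (λ z → partner z ≡ just (rot m b)) ma≡c (rotated pab)

swappedLoops-same : ∀ {π} {S S′ : SecStruct π} {h} → h + h ≡ Nb π →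
  (ℓ : InternalLoop S) (ℓ′ : InternalLoop S′) → PairsSwappedBy h ℓ → PairsSwappedBy h ℓ′ →
  let open InternalLoop ℓ; open InternalLoop ℓ′ renaming (a to a′; b to b′; c to c′; d to d′) in
  off b c ≡ off b′ c′ → b′ ≡ b ⊎ b′ ≡ rot h b → SameLoop ℓ ℓ′
swappedLoops-same {h = h} h+h≡N ℓ ℓ′ (ha≡c , hb≡d) (ha′≡c′ , hb′≡d′) β≡β′ (inj₁ refl) =
  inj₁ (trans (sym (rot-half-sym h+h≡N ha≡c)) (trans (cong (rot h) c≡c′) (rot-half-sym h+h≡N ha′≡c′)) ,
        refl , c≡c′ , trans (sym hb≡d) hb′≡d′)
  where
  open InternalLoop ℓ
  open InternalLoop ℓ′ using () renaming (c to c′)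
  c≡c′ : c ≡ c′
  c≡c′ = trans (sym (rot-off b c)) (trans (cong (λ t → rot t b) β≡β′) (rot-off b c′))
swappedLoops-same {h = h} h+h≡N ℓ ℓ′ (ha≡c , hb≡d) (ha′≡c′ , hb′≡d′) β≡β′ (inj₂ refl) =
  inj₂ (a≡c′ , trans (sym (rot-half h+h≡N b)) hb′≡d′ ,
        trans (sym ha≡c) (trans (cong (rot h) a≡c′) (rot-half-sym h+h≡N ha′≡c′)) , sym hb≡d)
  where
  open InternalLoop ℓ
  open InternalLoop ℓ′ using () renaming (c to c′)
  a≡c′ : a ≡ c′
  a≡c′ = begin
    a                                ≡⟨ rot-half-sym h+h≡N ha≡c ⟨
    rot h c                          ≡⟨ cong (rot h) (rot-off b c) ⟨
    rot h (rot (off b c) b)          ≡⟨ rot-comm h (off b c) b ⟩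
    rot (off b c) (rot h b)          ≡⟨ cong (λ t → rot t (rot h b)) β≡β′ ⟩
    rot (off (rot h b) c′) (rot h b) ≡⟨ rot-off (rot h b) c′ ⟩
    c′                               ∎
    where open ≡-Reasoning

complement : Base → Base
complement A = T
complement T = A
complement C = G
complement G = C

Compl⇒≡complement : ∀ {x z} → Compl x z → x ≡ complement z
Compl⇒≡complement AT = refl
Compl⇒≡complement TA = refl
Compl⇒≡complement CG = refl
Compl⇒≡complement GC = refl

eqB-refl : ∀ x → eqB x x ≡ true
eqB-refl A = refl
eqB-refl C = refl
eqB-refl G = refl
eqB-refl T = refl

positionsOf : Base → ℕ → Strand → List ℕ
positionsOf B o []      = []
positionsOf B o (x ∷ r) = if eqB B x then o ∷ positionsOf B (suc o) r else positionsOf B (suc o) r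

complementaryPairsIn : ℕ → Strand → List (ℕ × ℕ)
complementaryPairsIn o []      = []
complementaryPairsIn o (x ∷ r) =
  map (o ,_) (positionsOf (complement x) (suc o) r) ++ complementaryPairsIn (suc o) r

complementaryPairs : ℕ → Ordering → List (ℕ × ℕ)
complementaryPairs o []      = []
complementaryPairs o (s ∷ y) = complementaryPairsIn o s ++ complementaryPairs (o + length s) y

pairCount : Strand → ℕ
pairCount s = count A s * count T s + count G s * count C s

length-positionsOf : ∀ B o r → length (positionsOf B o r) ≡ count B r
length-positionsOf B o []      = refl
length-positionsOf B o (x ∷ r) with eqB B x
... | true  = cong suc (length-positionsOf B (suc o) r)
... | false = length-positionsOf B (suc o) r

pairCount-∷ : ∀ x r → pairCount (x ∷ r) ≡ count (complement x) r + pairCount r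
pairCount-∷ A r = +-assoc (count T r) _ _
pairCount-∷ T r = trans (cong (_+ count G r * count C r) (*-suc (count A r) (count T r))) (+-assoc (count A r) _ _)
pairCount-∷ C r = trans (cong (count A r * count T r +_) (*-suc (count G r) (count C r)))
                        (x∙yz≈y∙xz (count A r * count T r) (count G r) _)
pairCount-∷ G r = x∙yz≈y∙xz (count A r * count T r) (count C r) _

length-complementaryPairsIn : ∀ o s → length (complementaryPairsIn o s) ≡ pairCount s
length-complementaryPairsIn o []      = refl
length-complementaryPairsIn o (x ∷ r) = begin
  length (complementaryPairsIn o (x ∷ r))                          ≡⟨ length-++ (map (o ,_) ps) ⟩
  length (map (o ,_) ps) + length (complementaryPairsIn (suc o) r) ≡⟨ cong₂ _+_ (trans (length-map (o ,_) ps)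
                                                                        (length-positionsOf (complement x) (suc o) r))
                                                                        (length-complementaryPairsIn (suc o) r) ⟩
  count (complement x) r + pairCount r                             ≡⟨ pairCount-∷ x r ⟨
  pairCount (x ∷ r)                                                ∎
  where
  open ≡-Reasoning
  ps = positionsOf (complement x) (suc o) r

length-complementaryPairs : ∀ o y → length (complementaryPairs o y) ≡ bound y
length-complementaryPairs o []      = refl
length-complementaryPairs o (s ∷ y) = trans (length-++ (complementaryPairsIn o s))
  (cong₂ _+_ (length-complementaryPairsIn o s) (length-complementaryPairs (o + length s) y))

positionsOf-∈ : ∀ B o r i → lookupℕ r i ≡ just B → o + i ∈ positionsOf B o r
positionsOf-∈ B o (x ∷ r) zero    refl rewrite eqB-refl B = here (+-identityʳ o)
positionsOf-∈ B o (x ∷ r) (suc i) ri≡B with eqB B x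
... | true  = there (subst (_∈ positionsOf B (suc o) r) (sym (+-suc o i)) (positionsOf-∈ B (suc o) r i ri≡B))
... | false = subst (_∈ positionsOf B (suc o) r) (sym (+-suc o i)) (positionsOf-∈ B (suc o) r i ri≡B)

complementaryPairsIn-∈ : ∀ o s {i j x} → i < j → lookupℕ s i ≡ just x → lookupℕ s j ≡ just (complement x) →
                         (o + i , o + j) ∈ complementaryPairsIn o s
complementaryPairsIn-∈ o (x ∷ r) {zero} {suc j} _ refl sj≡ = ∈-++⁺ˡ (subst₂ (λ p q → (p , q) ∈ map (o ,_) ps)
  (sym (+-identityʳ o)) (sym (+-suc o j)) (∈-map⁺ (o ,_) (positionsOf-∈ (complement x) (suc o) r j sj≡)))
  where ps = positionsOf (complement x) (suc o) r
complementaryPairsIn-∈ o (x ∷ r) {suc i} {suc j} (s≤s i<j) si≡ sj≡ = ∈-++⁺ʳ (map (o ,_) _)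
  (subst₂ (λ p q → (p , q) ∈ complementaryPairsIn (suc o) r) (sym (+-suc o i)) (sym (+-suc o j))
    (complementaryPairsIn-∈ (suc o) r i<j si≡ sj≡))

bondedℕ-∷ʳ : ∀ s y z → bondedℕ (s ∷ y) (length s + z) ≡ bondedℕ y z
bondedℕ-∷ʳ []            y z = refl
bondedℕ-∷ʳ (x ∷ [])      y z = refl
bondedℕ-∷ʳ (x ∷ x′ ∷ r) y z = bondedℕ-∷ʳ (x′ ∷ r) y z

complementaryPairs-∈ : ∀ o y {w n x} → 0 < n → BondedRun y w n →
  lookupℕ (concat y) w ≡ just x → lookupℕ (concat y) (w + n) ≡ just (complement x) →
  (o + w , o + (w + n)) ∈ complementaryPairs o y
complementaryPairs-∈ o [] 0<n run _ _ with run 0 0<n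
... | ()
complementaryPairs-∈ o (s ∷ y) {w} {n} {x} 0<n run yw yu with w <? length s
... | yes w<s = ∈-++⁺ˡ (complementaryPairsIn-∈ o s (m<m+n w 0<n)
                  (trans (sym (lookupℕ-++ˡ s (concat y) w<s)) yw) (trans (sym (lookupℕ-++ˡ s (concat y) u<s)) yu))
  where
  Nb[s]≡ : Nb [ s ] ≡ length s
  Nb[s]≡ = cong length (++-identityʳ s)
  u<s : w + n < length s
  u<s = subst (w + n <_) Nb[s]≡ (proj₁ (run-confined [ s ] (bondedℕ (s ∷ y)) (λ z → bondedℕ-++ˡ [ s ] y)
          n (subst (w <_) (sym Nb[s]≡) w<s) run))
... | no w≮s with m≤n⇒∃[o]m+o≡n (≮⇒≥ w≮s)
...   | w′ , refl = ∈-++⁺ʳ (complementaryPairsIn o s) (subst₂ (λ p q → (p , q) ∈ complementaryPairs (o + l) y)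
          (+-assoc o l w′) (trans (+-assoc o l (w′ + n)) (cong (o +_) (sym (+-assoc l w′ n))))
          (complementaryPairs-∈ (o + l) y 0<n run′ yw′ yu′))
  where
  l = length s
  run′ : BondedRun y w′ n
  run′ t t<n = trans (sym (bondedℕ-∷ʳ s y (w′ + t)))
    (subst (λ z → bondedℕ (s ∷ y) z ≡ true) (+-assoc l w′ t) (run t t<n))
  yw′ : lookupℕ (concat y) w′ ≡ just x
  yw′ = trans (sym (lookupℕ-++ʳ s (concat y) w′)) yw
  yu′ : lookupℕ (concat y) (w′ + n) ≡ just (complement x)
  yu′ = trans (sym (lookupℕ-++ʳ s (concat y) (w′ + n)))
          (trans (cong (lookupℕ (s ++ concat y)) (sym (+-assoc l w′ n))) yu)

unique⇒length≤ : {A : Set} {xs ys : List A} → Unique xs → All (_∈ ys) xs → length xs ≤ length ys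
unique⇒length≤ {xs = []}     _                _                   = z≤n
unique⇒length≤ {xs = x ∷ xs} (x∉xs ∷ unique) (x∈ys ∷ xs⊆ys) with ∈-∃++ x∈ys
... | ys₁ , ys₂ , refl = begin
  suc (length xs)                   ≤⟨ s≤s (unique⇒length≤ unique (All.zipWith (λ (q∈ , x≢q) → remove q∈ x≢q) (xs⊆ys , x∉xs))) ⟩
  suc (length (ys₁ ++ ys₂))         ≡⟨ cong suc (length-++ ys₁) ⟩
  suc (length ys₁ + length ys₂)     ≡⟨ +-suc (length ys₁) (length ys₂) ⟨
  length ys₁ + length (x ∷ ys₂)     ≡⟨ length-++ ys₁ ⟨
  length (ys₁ ++ x ∷ ys₂)           ∎
  where
  open ≤-Reasoning
  remove : ∀ {q} → q ∈ ys₁ ++ x ∷ ys₂ → x ≢ q → q ∈ ys₁ ++ ys₂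
  remove q∈ x≢q with ∈-++⁻ ys₁ q∈
  ... | inj₁ q∈₁          = ∈-++⁺ˡ q∈₁
  ... | inj₂ (here q≡x)   = ⊥-elim (x≢q (sym q≡x))
  ... | inj₂ (there q∈₂)  = ∈-++⁺ʳ ys₁ q∈₂

module Doubled (y : Ordering) .{{_ : NonZero (Nb y)}} where
  private
    L = Nb y
    Y = concat y

  Nb-doubled : Nb (y ++ y) ≡ L + L
  Nb-doubled = Nb-++ y y

  instance
    nonZero-doubled : NonZero (Nb (y ++ y))
    nonZero-doubled = >-nonZero (subst (0 <_) (sym Nb-doubled) (<-≤-trans (>-nonZero⁻¹ L) (m≤m+n L L)))

  toℕ<L+L : (x : Fin (Nb (y ++ y))) → toℕ x < L + L
  toℕ<L+L x = subst (toℕ x <_) Nb-doubled (toℕ<n x)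

  split-doubled : ∀ {x} → x < L + L → x ≡ x % L ⊎ x ≡ L + x % L
  split-doubled {x} x<2L with x <? L
  ... | yes x<L = inj₁ (sym (m<n⇒m%n≡m x<L))
  ... | no x≮L  = inj₂ (trans (sym (n≤m<n+n⇒m%n+n≡m (≮⇒≥ x≮L) x<2L)) (+-comm (x % L) L))

  agree-on-halves : {B : Set} (f g : ℕ → B) → (∀ z → z < L → f z ≡ g z) → (∀ z → f (L + z) ≡ g z) →
                    ∀ {x} → x < L + L → f x ≡ g (x % L)
  agree-on-halves f g low high {x} x<2L with split-doubled x<2L
  ... | inj₁ x≡ = trans (cong f x≡) (low (x % L) (m%n<n x L))
  ... | inj₂ x≡ = trans (cong f x≡) (high (x % L))

  residue : Fin (Nb (y ++ y)) → ℕ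
  residue x = toℕ x % L

  residue<L : ∀ x → residue x < L
  residue<L x = m%n<n (toℕ x) L

  residue-rot : ∀ t x → residue (rot t x) ≡ (residue x + t) % L
  residue-rot t x = begin
    toℕ (rot t x) % L                    ≡⟨ cong (_% L) (toℕ-rot t x) ⟩
    (toℕ x + t) % Nb (y ++ y) % L        ≡⟨ m∣n⇒o%n%m≡o%m L (Nb (y ++ y)) (toℕ x + t) L∣N ⟩
    (toℕ x + t) % L                      ≡⟨ [m%o+n]%o≡[m+n]%o (toℕ x) t L ⟨
    (toℕ x % L + t) % L                  ∎
    where
    open ≡-Reasoning
    L∣N : L ∣ Nb (y ++ y)
    L∣N = divides 2 (trans Nb-doubled (cong (L +_) (sym (+-identityʳ L))))

  bonded⇒bondedℕ-residue : ∀ x → Bonded (y ++ y) x → bondedℕ y (residue x) ≡ true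
  bonded⇒bondedℕ-residue x bx = trans (sym (agree-on-halves (bondedℕ (y ++ y)) (bondedℕ y)
    (λ z → bondedℕ-++ˡ y y) (bondedℕ-++ʳ y y) (toℕ<L+L x))) bx

  lookupℕ-residue : ∀ x → lookupℕ Y (residue x) ≡ just (baseAt (y ++ y) x)
  lookupℕ-residue x = begin
    lookupℕ Y (residue x)                   ≡⟨ agree-on-halves (lookupℕ (Y ++ Y)) (lookupℕ Y)
                                                 (λ z → lookupℕ-++ˡ Y Y) (lookupℕ-++ʳ Y Y) (toℕ<L+L x) ⟨
    lookupℕ (Y ++ Y) (toℕ x)                ≡⟨ cong (λ l → lookupℕ l (toℕ x)) (concat-++ y y) ⟩
    lookupℕ (concat (y ++ y)) (toℕ x)       ≡⟨ lookupℕ-toℕ (concat (y ++ y)) x ⟩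
    just (baseAt (y ++ y) x)                ∎
    where open ≡-Reasoning

  residue≡⇒same-or-halfTurn : ∀ p q → residue p ≡ residue q → q ≡ p ⊎ q ≡ rot L p
  residue≡⇒same-or-halfTurn p q p≡q with split-doubled (toℕ<L+L p) | split-doubled (toℕ<L+L q)
  ... | inj₁ p≡ | inj₁ q≡ = inj₁ (toℕ-injective (trans q≡ (trans (sym p≡q) (sym p≡))))
  ... | inj₂ p≡ | inj₂ q≡ = inj₁ (toℕ-injective (trans q≡ (trans (cong (L +_) (sym p≡q)) (sym p≡))))
  ... | inj₁ p≡ | inj₂ q≡ = inj₂ (toℕ-injective (begin
    toℕ q                           ≡⟨ q≡ ⟩
    L + residue q                   ≡⟨ cong (L +_) p≡q ⟨
    L + residue p                   ≡⟨ +-comm L (residue p) ⟩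
    residue p + L                   ≡⟨ m<n⇒m%n≡m (subst (residue p + L <_) (sym Nb-doubled) (+-monoˡ-< L (residue<L p))) ⟨
    (residue p + L) % Nb (y ++ y)   ≡⟨ cong (λ z → (z + L) % Nb (y ++ y)) p≡ ⟨
    (toℕ p + L) % Nb (y ++ y)       ≡⟨ toℕ-rot L p ⟨
    toℕ (rot L p)                   ∎))
    where open ≡-Reasoning
  ... | inj₂ p≡ | inj₁ q≡ = inj₂ (toℕ-injective (begin
    toℕ q                                 ≡⟨ q≡ ⟩
    residue q                             ≡⟨ p≡q ⟨
    residue p                             ≡⟨ m<n⇒m%n≡m (<-≤-trans (residue<L p) (≤-trans (m≤m+n L L) (≤-reflexive (sym Nb-doubled)))) ⟨
    residue p % Nb (y ++ y)               ≡⟨ [m+n]%n≡m%n (residue p) (Nb (y ++ y)) ⟨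
    (residue p + Nb (y ++ y)) % Nb (y ++ y) ≡⟨ cong (_% Nb (y ++ y)) (begin
      residue p + Nb (y ++ y)                 ≡⟨ cong (residue p +_) Nb-doubled ⟩
      residue p + (L + L)                     ≡⟨ +-assoc (residue p) L L ⟨
      residue p + L + L                       ≡⟨ cong (_+ L) (trans (+-comm (residue p) L) (sym p≡)) ⟩
      toℕ p + L                               ∎) ⟩
    (toℕ p + L) % Nb (y ++ y)             ≡⟨ toℕ-rot L p ⟨
    toℕ (rot L p)                         ∎))
    where open ≡-Reasoning

  module _ {F : Fundamental (y ++ y)} (e : Entry (y ++ y) F) where
    open Entry e
    open InternalLoop loop
    open SecStruct S using (compl)

    loop-swapped : PairsSwappedBy L loop
    loop-swapped = subst (λ h → PairsSwappedBy h loop) (double-injective (trans m+m≡N Nb-doubled))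
                     (centralLoop-halfTurn m+m≡N inv-kL loop central)
      where
      m+m≡N : k * Fundamental.L F + k * Fundamental.L F ≡ Nb (y ++ y)
      m+m≡N = twoFold⇒halfTurn S F twofold
      inv-kL : InvariantUnder S (k * Fundamental.L F)
      inv-kL = proj₁ (proj₂ (proj₂ twofold))

    footprint : ℕ × ℕ
    footprint = residue b , residue b + off b c

    footprint∈complementaryPairs : footprint ∈ complementaryPairs 0 y
    footprint∈complementaryPairs = complementaryPairs-∈ 0 y pos-bc (proj₂ confined) (lookupℕ-residue b) (begin
      lookupℕ Y (residue b + off b c)    ≡⟨ cong (lookupℕ Y) residue-c ⟨
      lookupℕ Y (residue c)              ≡⟨ cong (lookupℕ Y) residue-a ⟩
      lookupℕ Y (residue a)              ≡⟨ lookupℕ-residue a ⟩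
      just (baseAt (y ++ y) a)           ≡⟨ cong just (Compl⇒≡complement (compl a b pab)) ⟩
      just (complement (baseAt (y ++ y) b)) ∎)
      where
      open ≡-Reasoning
      cyclic : ∀ t → t < off b c → bondedℕ y ((residue b + t) % L) ≡ true
      cyclic t t<β = subst (λ z → bondedℕ y z ≡ true) (residue-rot t b) (bonded⇒bondedℕ-residue (rot t b)
        (nonick-bc (rot t b) (subst (_< off b c) (sym (off-unique b (rot t b) (<-trans t<β (off<N b c)) refl)) t<β)))
      confined : residue b + off b c < L × BondedRun y (residue b) (off b c)
      confined = run-confined y (λ z → bondedℕ y (z % L)) (λ z z<L → cong (bondedℕ y) (m<n⇒m%n≡m z<L))
                   (off b c) (residue<L b) cyclic
      residue-c : residue c ≡ residue b + off b c
      residue-c = trans (cong residue (sym (rot-off b c))) (trans (residue-rot (off b c) b) (m<n⇒m%n≡m (proj₁ confined)))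
      residue-a : residue c ≡ residue a
      residue-a = begin
        residue c                ≡⟨ m%n%n≡m%n (toℕ c) L ⟨
        residue c % L            ≡⟨ [m+n]%n≡m%n (residue c) L ⟨
        (residue c + L) % L      ≡⟨ residue-rot L c ⟨
        residue (rot L c)        ≡⟨ cong residue (rot-half-sym (sym Nb-doubled) (proj₁ loop-swapped)) ⟩
        residue a                ∎

  footprint-injective : ∀ {F} (e e′ : Entry (y ++ y) F) → footprint e ≡ footprint e′ →
                        SameLoop (Entry.loop e) (Entry.loop e′)
  footprint-injective e e′ eq = swappedLoops-same (sym Nb-doubled) (Entry.loop e) (Entry.loop e′)
    (loop-swapped e) (loop-swapped e′) β≡β′ (residue≡⇒same-or-halfTurn b b′ (cong proj₁ eq))
    where
    open InternalLoop (Entry.loop e)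
    open InternalLoop (Entry.loop e′) using () renaming (b to b′; c to c′)
    β≡β′ : off b c ≡ off b′ c′
    β≡β′ = +-cancelˡ-≡ (residue b) _ _ (trans (cong proj₂ eq) (cong (_+ off b′ c′) (sym (cong proj₁ eq))))

4xy≤[x+y]² : ∀ x y → 4 * (x * y) ≤ (x + y) * (x + y)
4xy≤[x+y]² x y = [ ordered , (λ y≤x → subst₂ _≤_ (cong (4 *_) (*-comm y x)) (cong₂ _*_ (+-comm y x) (+-comm y x))
                                                (ordered y≤x)) ]′ (≤-total x y)
  where
  square : ∀ x d → (x + (x + d)) * (x + (x + d)) ≡ 4 * (x * (x + d)) + d * d
  square = solve-∀
  ordered : ∀ {x y} → x ≤ y → 4 * (x * y) ≤ (x + y) * (x + y)
  ordered {x} x≤y with m≤n⇒∃[o]m+o≡n x≤y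
  ... | d , refl = subst (4 * (x * (x + d)) ≤_) (sym (square x d)) (m≤m+n _ (d * d))

x²+y²≤[x+y]² : ∀ x y → x * x + y * y ≤ (x + y) * (x + y)
x²+y²≤[x+y]² x y = subst (x * x + y * y ≤_) (sym (square x y)) (m≤m+n _ (2 * (x * y)))
  where
  square : ∀ x y → (x + y) * (x + y) ≡ (x * x + y * y) + 2 * (x * y)
  square = solve-∀

length≡count-sum : ∀ s → length s ≡ (count A s + count T s) + (count G s + count C s)
length≡count-sum []      = refl
length≡count-sum (A ∷ r) = cong suc (length≡count-sum r)
length≡count-sum (T ∷ r) = trans (cong suc (length≡count-sum r))
  (cong (_+ (count G r + count C r)) (sym (+-suc (count A r) (count T r))))
length≡count-sum (G ∷ r) = trans (cong suc (length≡count-sum r))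
  (sym (+-suc (count A r + count T r) (count G r + count C r)))
length≡count-sum (C ∷ r) = trans (cong suc (length≡count-sum r))
  (sym (trans (cong (count A r + count T r +_) (+-suc (count G r) (count C r))) (+-suc (count A r + count T r) _)))

4*pairCount≤length² : ∀ s → 4 * pairCount s ≤ length s * length s
4*pairCount≤length² s = begin
  4 * (nA * nT + nG * nC)                       ≡⟨ *-distribˡ-+ 4 (nA * nT) (nG * nC) ⟩
  4 * (nA * nT) + 4 * (nG * nC)                 ≤⟨ +-mono-≤ (4xy≤[x+y]² nA nT) (4xy≤[x+y]² nG nC) ⟩
  (nA + nT) * (nA + nT) + (nG + nC) * (nG + nC) ≤⟨ x²+y²≤[x+y]² (nA + nT) (nG + nC) ⟩
  (nA + nT + (nG + nC)) * (nA + nT + (nG + nC)) ≡⟨ cong (λ n → n * n) (length≡count-sum s) ⟨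
  length s * length s                           ∎
  where
  open ≤-Reasoning
  nA = count A s ; nT = count T s ; nG = count G s ; nC = count C s

4*bound≤Nb² : ∀ y → 4 * bound y ≤ Nb y * Nb y
4*bound≤Nb² []      = z≤n
4*bound≤Nb² (s ∷ y) = begin
  4 * (pairCount s + bound y)               ≡⟨ *-distribˡ-+ 4 (pairCount s) (bound y) ⟩
  4 * pairCount s + 4 * bound y             ≤⟨ +-mono-≤ (4*pairCount≤length² s) (4*bound≤Nb² y) ⟩
  length s * length s + Nb y * Nb y         ≤⟨ x²+y²≤[x+y]² (length s) (Nb y) ⟩
  (length s + Nb y) * (length s + Nb y)     ≡⟨ cong (λ n → n * n) (length-++ s) ⟨
  Nb (s ∷ y) * Nb (s ∷ y)                   ∎
  where open ≤-Reasoning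

16*bound≤Nb[y++y]² : ∀ y → 16 * bound y ≤ Nb (y ++ y) * Nb (y ++ y)
16*bound≤Nb[y++y]² y = begin
  16 * bound y                  ≡⟨ *-assoc 4 4 (bound y) ⟩
  4 * (4 * bound y)             ≤⟨ *-monoʳ-≤ 4 (4*bound≤Nb² y) ⟩
  4 * (Nb y * Nb y)             ≡⟨ quadruple (Nb y) ⟩
  (Nb y + Nb y) * (Nb y + Nb y) ≡⟨ cong (λ n → n * n) (Nb-++ y y) ⟨
  Nb (y ++ y) * Nb (y ++ y)     ∎
  where
  open ≤-Reasoning
  quadruple : ∀ n → 4 * (n * n) ≡ (n + n) * (n + n)
  quadruple = solve-∀

nonZero-Nb : ∀ π → π ≢ [] → All (_≢ []) π → NonZero (Nb π)
nonZero-Nb []            π≢[] _            = ⊥-elim (π≢[] refl)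
nonZero-Nb ([] ∷ _)      _    (s≢[] ∷ _) = ⊥-elim (s≢[] refl)
nonZero-Nb ((_ ∷ _) ∷ _) _    _            = _

lemma7 : (π : Ordering) → π ≢ [] → All (λ s → s ≢ []) π →
    (F : Fundamental π) → (𝒯 : List (Entry π F)) →
    AllPairs (λ e e′ → ¬ SameLoop (Entry.loop e) (Entry.loop e′)) 𝒯 →
    (y : Ordering) → π ≡ y ++ y →
    length 𝒯 ≤ bound y × 16 * bound y ≤ Nb π * Nb π
lemma7 π π≢[] strands≢[] F 𝒯 distinct y refl = count-bound , 16*bound≤Nb[y++y]² y
  where
  instance
    nonZero-y : NonZero (Nb y)
    nonZero-y = nonZero-Nb y (λ { refl → π≢[] refl }) (All.++⁻ˡ y strands≢[])
  open Doubled y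
  footprints-unique : Unique (map footprint 𝒯)
  footprints-unique = AllPairs.map⁺ (AllPairs.map (λ {e} {e′} ¬same eq → ¬same (footprint-injective e e′ eq)) distinct)
  count-bound : length 𝒯 ≤ bound y
  count-bound = begin
    length 𝒯                         ≡⟨ length-map footprint 𝒯 ⟨
    length (map footprint 𝒯)         ≤⟨ unique⇒length≤ footprints-unique
                                           (All.map⁺ (All.universal footprint∈complementaryPairs 𝒯)) ⟩
    length (complementaryPairs 0 y)  ≡⟨ length-complementaryPairs 0 y ⟩
    bound y                          ∎
    where open ≤-Reasoning
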